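{- Let $G=(X,Y,E)$ be a finite bipartite graph. Then $G$ is 2-chordal bipartite if and only if both of the following hold: (i) $G$ is chordal bipartite; (ii) for each edge $e\in E$, the graph $G_e=(X,Y,E\setminus\{e\})$ obtained from $G$ by deleting the edge $e$ (keeping all vertices) is chordal bipartite.
   Context: Graphs are finite and simple. A bipartite graph $G=(X,Y,E)$ has disjoint vertex classes $X,Y$ and every edge joins a vertex of $X$ to a vertex of $Y$. A chord of a cycle $C$ in $G$ is an edge of $G$ joining two vertices of $C$ that is not itself an edge of $C$. A bipartite graph is chordal bipartite if every cycle of length at least $6$ has at least one chord. A bipartite graph is 2-chordal bipartite (also called doubly chordal bipartite) if every cycle of length at least $6$ has at least two chords. -}

module Defs where

open import Data.Nat using (ℕ; suc; _≤_)
open import Data.Nat.DivMod using (_%_; m%n<n)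
open import Data.Fin using (Fin; toℕ; fromℕ<)
open import Data.Fin.Properties using (_≟_)
open import Data.Bool using (Bool; true; false; _∧_; not)
open import Data.Product using (Σ; _×_; ∃; ∃-syntax)
open import Function.Definitions using (Injective)
open import Relation.Binary.PropositionalEquality using (_≡_; _≢_)
open import Relation.Nullary using (¬_)
open import Relation.Nullary.Decidable using (⌊_⌋)

-- Simplicity is automatic (a relation between X and Y).
BipGraph : ℕ → ℕ → Set
BipGraph m n = Fin m → Fin n → Bool

next : {k : ℕ} → Fin (suc k) → Fin (suc k)
next {k} i = fromℕ< (m%n<n (suc (toℕ i)) (suc k))

-- A cycle of length 2k (k ≥ 1 here, indices Fin (suc k')) in G:
--   x₀ y₀ x₁ y₁ … x_{k-1} y_{k-1} (x₀),
-- with pairwise distinct xᵢ ∈ X, pairwise distinct yᵢ ∈ Y,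
-- and edges xᵢyᵢ and y_i x_{i+1 mod k}.
record Cycle {m n : ℕ} (G : BipGraph m n) (k : ℕ) : Set where
  field
    xs : Fin (suc k) → Fin m
    ys : Fin (suc k) → Fin n
    xs-inj : Injective _≡_ _≡_ xs
    ys-inj : Injective _≡_ _≡_ ys
    edge₁ : ∀ i → G (xs i) (ys i) ≡ true
    edge₂ : ∀ i → G (xs (next i)) (ys i) ≡ true

-- Chords are identified by the index pair (i , j);
-- as xs, ys are injective, distinct index pairs are distinct edges.
IsChord : {m n k : ℕ} {G : BipGraph m n} → Cycle G k → Fin (suc k) → Fin (suc k) → Set
IsChord {G = G} C i j =
  G (Cycle.xs C i) (Cycle.ys C j) ≡ true × i ≢ j × i ≢ next j

-- cycle length is 2 (suc k), so "length ≥ 6" is 2 ≤ k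
ChordalBipartite : {m n : ℕ} → BipGraph m n → Set
ChordalBipartite G =
  ∀ k → 2 ≤ k → (C : Cycle G k) → ∃[ i ] ∃[ j ] IsChord C i j

TwoChordalBipartite : {m n : ℕ} → BipGraph m n → Set
TwoChordalBipartite G =
  ∀ k → 2 ≤ k → (C : Cycle G k) →
    ∃[ i ] ∃[ j ] ∃[ i' ] ∃[ j' ]
      (IsChord C i j × IsChord C i' j' × ¬ (i ≡ i' × j ≡ j'))

deleteEdge : {m n : ℕ} → BipGraph m n → Fin m → Fin n → BipGraph m n
deleteEdge G x₀ y₀ x y = G x y ∧ not (⌊ x ≟ x₀ ⌋ ∧ ⌊ y ≟ y₀ ⌋)

-- Cycles of G − e are cycles of G, and deleting e destroys at most one chord of a cycle,
-- namely e itself. So a cycle of G − e with two chords in G keeps one of them. Conversely,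
-- if C has a chord e in G, then C is also a cycle of G − e (e is not one of its edges), and
-- a chord of C there is a second chord of C in G, different from e.
module Submission where

open import Defs
open import Data.Nat using (ℕ)
open import Data.Fin using (Fin)
open import Data.Fin.Properties using (_≟_)
open import Data.Bool using (true)
open import Data.Product using (_×_; _,_; proj₁; proj₂; map₁)
open import Data.Sum using (_⊎_; inj₁; inj₂)
open import Relation.Nullary using (¬_; yes; no; contradiction)
open import Relation.Binary.PropositionalEquality using (_≡_; _≢_; refl; sym; trans; cong)
open import Function.Base using (_∘_)
open import Function.Bundles using (_⇔_; mk⇔)

private
  variable
    m n k : ℕ

_⊆_ : BipGraph m n → BipGraph m n → Set
H ⊆ G = ∀ x y → H x y ≡ true → G x y ≡ true

module _ {G : BipGraph m n} {x₀ : Fin m} {y₀ : Fin n} where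

  deleteEdge-⊆ : deleteEdge G x₀ y₀ ⊆ G
  deleteEdge-⊆ x y e with G x y
  ... | true = refl

  deleteEdge-removes : deleteEdge G x₀ y₀ x₀ y₀ ≢ true
  deleteEdge-removes e with G x₀ y₀ | x₀ ≟ x₀ | y₀ ≟ y₀
  deleteEdge-removes () | true | yes _ | yes _
  ... | true | no x₀≢x₀ | _         = x₀≢x₀ refl
  ... | true | yes _    | no y₀≢y₀  = y₀≢y₀ refl

  deleteEdge-keeps : ∀ {x y} → G x y ≡ true → ¬ (x ≡ x₀ × y ≡ y₀) →
                     deleteEdge G x₀ y₀ x y ≡ true
  deleteEdge-keeps {x} {y} e x≢y with G x y | x ≟ x₀ | y ≟ y₀
  ... | true | yes x≡x₀ | yes y≡y₀ = contradiction (x≡x₀ , y≡y₀) x≢y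
  ... | true | yes _    | no _     = refl
  ... | true | no _     | _        = refl

Cycle-mono : {H G : BipGraph m n} → H ⊆ G → Cycle H k → Cycle G k
Cycle-mono H⊆G C = record
  { xs = xs ; ys = ys ; xs-inj = xs-inj ; ys-inj = ys-inj
  ; edge₁ = λ i → H⊆G _ _ (edge₁ i)
  ; edge₂ = λ i → H⊆G _ _ (edge₂ i)
  }
  where open Cycle C

module _ {G : BipGraph m n} (C : Cycle G k) where
  open Cycle C

  distinctIndexPairs-avoid : ∀ {i j i′ j′} → ¬ (i ≡ i′ × j ≡ j′) → ∀ x y →
                         ¬ (xs i ≡ x × ys j ≡ y) ⊎ ¬ (xs i′ ≡ x × ys j′ ≡ y)
  distinctIndexPairs-avoid {i} {j} {i′} {j′} ij≢i′j′ x y with xs i ≟ x | ys j ≟ y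
  ... | no xsi≢x | _         = inj₁ (xsi≢x ∘ proj₁)
  ... | yes _    | no ysj≢y  = inj₁ (ysj≢y ∘ proj₂)
  ... | yes xsi≡x | yes ysj≡y = inj₂ λ (xsi′≡x , ysj′≡y) →
    ij≢i′j′ (xs-inj (trans xsi≡x (sym xsi′≡x)) , ys-inj (trans ysj≡y (sym ysj′≡y)))

  chord-notCycleEdge₁ : ∀ {i j} → IsChord C i j → ∀ l → ¬ (xs l ≡ xs i × ys l ≡ ys j)
  chord-notCycleEdge₁ (_ , i≢j , _) l (xsl≡xsi , ysl≡ysj) =
    i≢j (trans (sym (xs-inj xsl≡xsi)) (ys-inj ysl≡ysj))

  chord-notCycleEdge₂ : ∀ {i j} → IsChord C i j → ∀ l → ¬ (xs (next l) ≡ xs i × ys l ≡ ys j)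
  chord-notCycleEdge₂ (_ , _ , i≢next-j) l (xsnl≡xsi , ysl≡ysj) =
    i≢next-j (trans (sym (xs-inj xsnl≡xsi)) (cong next (ys-inj ysl≡ysj)))

  deleteChord : ∀ {i j} → IsChord C i j → Cycle (deleteEdge G (xs i) (ys j)) k
  deleteChord ch = record
    { xs = xs ; ys = ys ; xs-inj = xs-inj ; ys-inj = ys-inj
    ; edge₁ = λ l → deleteEdge-keeps {G = G} (edge₁ l) (chord-notCycleEdge₁ ch l)
    ; edge₂ = λ l → deleteEdge-keeps {G = G} (edge₂ l) (chord-notCycleEdge₂ ch l)
    }

IsChord-mono : {H G : BipGraph m n} (H⊆G : H ⊆ G) (C : Cycle H k) →
               ∀ {i j} → IsChord C i j → IsChord (Cycle-mono H⊆G C) i j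
IsChord-mono H⊆G C = map₁ (H⊆G _ _)

IsChord-deleteEdge : {G : BipGraph m n} {x₀ : Fin m} {y₀ : Fin n}
                     (C : Cycle (deleteEdge G x₀ y₀) k) → ∀ {i j} →
                     IsChord (Cycle-mono deleteEdge-⊆ C) i j →
                     ¬ (Cycle.xs C i ≡ x₀ × Cycle.ys C j ≡ y₀) → IsChord C i j
IsChord-deleteEdge {G = G} C (e , rest) avoid = deleteEdge-keeps {G = G} e avoid , rest

module _ {G : BipGraph m n} where

  TwoChordalBipartite⇒ChordalBipartite : TwoChordalBipartite G → ChordalBipartite G
  TwoChordalBipartite⇒ChordalBipartite two k 2≤k C
    with i , j , _ , _ , ch , _ ← two k 2≤k C = i , j , ch

  TwoChordalBipartite⇒ChordalBipartite-deleteEdge :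
    TwoChordalBipartite G → ∀ x y → ChordalBipartite (deleteEdge G x y)
  TwoChordalBipartite⇒ChordalBipartite-deleteEdge two x y k 2≤k C
    with i , j , i′ , j′ , ch , ch′ , ij≢i′j′ ← two k 2≤k (Cycle-mono deleteEdge-⊆ C)
    with distinctIndexPairs-avoid (Cycle-mono deleteEdge-⊆ C) ij≢i′j′ x y
  ... | inj₁ avoid = i  , j  , IsChord-deleteEdge C ch avoid
  ... | inj₂ avoid = i′ , j′ , IsChord-deleteEdge C ch′ avoid

  ChordalBipartite-deleteEdge⇒TwoChordalBipartite :
    ChordalBipartite G → (∀ x y → G x y ≡ true → ChordalBipartite (deleteEdge G x y)) →
    TwoChordalBipartite G
  ChordalBipartite-deleteEdge⇒TwoChordalBipartite chordal chordal-e k 2≤k C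
    with i , j , ch ← chordal k 2≤k C
    with i′ , j′ , ch′ ← chordal-e _ _ (proj₁ ch) k 2≤k (deleteChord C ch)
    = i , j , i′ , j′ , ch , IsChord-mono deleteEdge-⊆ (deleteChord C ch) ch′ , distinct
    where
    distinct : ¬ (i ≡ i′ × j ≡ j′)
    distinct (refl , refl) = deleteEdge-removes {G = G} (proj₁ ch′)

theorem3p1 : {m n : ℕ} (G : BipGraph m n) →
    TwoChordalBipartite G ⇔
      (ChordalBipartite G ×
        ((x : Fin m) (y : Fin n) → G x y ≡ true → ChordalBipartite (deleteEdge G x y)))
theorem3p1 G = mk⇔
  (λ two → TwoChordalBipartite⇒ChordalBipartite two
         , λ x y _ → TwoChordalBipartite⇒ChordalBipartite-deleteEdge two x y)
  (λ (chordal , chordal-e) → ChordalBipartite-deleteEdge⇒TwoChordalBipartite chordal chordal-e)
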